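{- Let $p$ be a prime, $\mathbb F_q$ a finite field of characteristic $p$, $G=\mathbb Z/p\mathbb Z$, and $V=\bigoplus_{\lambda=1}^lV_{d_\lambda}$ a representation of $G$ over $\mathbb F_q$ with $D_V=p$. Then for every integer $j>0$ with $p\nmid j$, $$\dim C_j-\mathbf v(j)\le-1,$$ and moreover $\dim C_{p-1}-\mathbf v(p-1)=-1$.
   Context: For $1\le i\le p$, $V_i$ denotes the unique $i$-dimensional indecomposable linear representation of $G$ over $\mathbb F_q$; $1\le d_\lambda\le p$, $d=\sum_\lambda d_\lambda$, and $D_V:=\sum_{\lambda=1}^l\frac{(d_\lambda-1)d_\lambda}{2}$. For $j>0$ with $p\nmid j$, $\mathrm{sht}_V(j):=\sum_{\lambda=1}^l\sum_{i=1}^{d_\lambda-1}\lfloor ij/p\rfloor$ and $\mathbf v(j):=d-l+\mathrm{sht}_V(j)$. Let $\Delta_G$ be the ind-Deligne–Mumford stack over $\mathbb F_q$ classifying $G$-torsors over $A(\!(t)\!)=A[[t]][t^{ -1}]$ for $\mathbb F_q$-algebras $A$, and $C_j\subset|\Delta_G|$ the locus of torsors with (unique) ramification jump $j$; its coarse moduli space is the ind-perfection of $\mathbb G_m\times\mathbb A^{j-\lfloor j/p\rfloor-1}$, so $\dim C_j=j-\lfloor j/p\rfloor$. -}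

module Defs where

open import Data.Nat using (ℕ; zero; suc; _+_; _*_; _∸_; _/_)
open import Data.Nat.Primality using (Prime; prime⇒nonZero)
open import Data.List using (List; []; _∷_; map; length; upTo)
open import Data.Nat.ListAction using (sum)
open import Data.Integer using (ℤ; +_; _-_)

⌊_/_⌋[_] : ℕ → (p : ℕ) → Prime p → ℕ
⌊ m / p ⌋[ pp ] = _/_ m p {{prime⇒nonZero pp}}

-- A representation V = ⊕_λ V_{d_λ} of G = ℤ/pℤ is encoded by the list ds = (d_1,…,d_l).
-- d = Σ_λ d_λ
dimV : List ℕ → ℕ
dimV ds = sum ds

numSummands : List ℕ → ℕ
numSummands ds = length ds

DV : List ℕ → ℕ
DV ds = sum (map (λ d → ((d ∸ 1) * d) / 2) ds)

shtBlock : (p : ℕ) → Prime p → ℕ → ℕ → ℕ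
shtBlock p pp j dλ = sum (map (λ k → ⌊ (suc k * j) / p ⌋[ pp ]) (upTo (dλ ∸ 1)))

sht : (p : ℕ) → Prime p → List ℕ → ℕ → ℕ
sht p pp ds j = sum (map (shtBlock p pp j) ds)

𝐯 : (p : ℕ) → Prime p → List ℕ → ℕ → ℤ
𝐯 p pp ds j = (+ dimV ds - + numSummands ds) Data.Integer.+ + sht p pp ds j

-- dim C_j = j - ⌊ j / p ⌋  (dimension of the coarse moduli space of the jump-j locus,
-- the ind-perfection of 𝔾_m × 𝔸^{j - ⌊j/p⌋ - 1}), as an integer
dimC : (p : ℕ) → Prime p → ℕ → ℤ
dimC p pp j = + j - + ⌊ j / p ⌋[ pp ]

-- Put c = Σ_λ (d_λ − 1) = d − l, so that dim C_j − v(j) = j − ⌊j/p⌋ − (c + sht_V(j)).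
-- Each term satisfies ij < p (⌊ij/p⌋ + 1); summing over 1 ≤ i < d_λ and over λ gives
-- c + D_V j ≤ p (c + sht_V(j)), and since D_V = p forces c > 0 this yields j < c + sht_V(j).
-- For j = p − 1 the floors are exact, ⌊i(p − 1)/p⌋ = i − 1 for i < p, so
-- c + sht_V(p − 1) = Σ_λ d_λ(d_λ − 1)/2 = D_V = p = j + 1, while ⌊(p − 1)/p⌋ = 0.

module Submission where

open import Defs
open import Data.Nat using (ℕ; _≤_; _<_; _∸_)
open import Data.Nat.Primality using (Prime)
open import Data.Nat.Divisibility using (_∣_)
open import Data.Integer using (ℤ; _-_; -[1+_]) renaming (_≤_ to _≤ℤ_)
open import Data.List using (List)
open import Data.List.Relation.Unary.All using (All)
open import Data.Product using (_×_)
open import Relation.Nullary using (¬_)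
open import Relation.Binary.PropositionalEquality using (_≡_)

open import Level using (Level)
open import Algebra.Properties.CommutativeSemigroup using (interchange)
open import Data.Nat using (zero; suc; _+_; _*_; _/_; _%_; NonZero; z≤n; s≤s)
open import Data.Nat.Properties
open import Data.Nat.DivMod
open import Data.Nat.Divisibility using (n∣m*n)
open import Data.Nat.Primality using (prime⇒nonZero)
open import Data.Nat.ListAction using (sum)
open import Data.Nat.ListAction.Properties using (sum-++)
open import Data.List using ([]; _∷_; _++_; map; upTo; length)
open import Data.List.Properties using (map-++; upTo-∷ʳ; length-upTo)
open import Data.List.Membership.Propositional.Properties using (∈-upTo⁻)
import Data.List.Relation.Unary.All as All
open import Data.Product using (_,_; proj₁; proj₂)
open import Data.Empty using (⊥-elim)
open import Relation.Binary.PropositionalEquality using (refl; sym; trans; cong; cong₂; subst; module ≡-Reasoning)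
import Data.Integer as ℤ
import Data.Integer.Properties as ℤ
import Data.Integer.Solver as ℤ-Solver

private
  variable
    a : Level
    A : Set a

sum-map-+ : ∀ (f g : A → ℕ) xs →
            sum (map (λ x → f x + g x) xs) ≡ sum (map f xs) + sum (map g xs)
sum-map-+ f g [] = refl
sum-map-+ f g (x ∷ xs) = trans (cong (f x + g x +_) (sum-map-+ f g xs))
                               (interchange +-commutativeSemigroup (f x) (g x) _ _)

sum-map-*ˡ : ∀ c (f : A → ℕ) xs →
             sum (map (λ x → c * f x) xs) ≡ c * sum (map f xs)
sum-map-*ˡ c f [] = sym (*-zeroʳ c)
sum-map-*ˡ c f (x ∷ xs) = trans (cong (c * f x +_) (sum-map-*ˡ c f xs))
                                (sym (*-distribˡ-+ c (f x) _))

sum-map-*ʳ : ∀ c (f : A → ℕ) xs →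
             sum (map (λ x → f x * c) xs) ≡ sum (map f xs) * c
sum-map-*ʳ c f [] = refl
sum-map-*ʳ c f (x ∷ xs) = trans (cong (f x * c +_) (sum-map-*ʳ c f xs))
                                (sym (*-distribʳ-+ c (f x) _))

sum-map-1 : ∀ (xs : List A) → sum (map (λ _ → 1) xs) ≡ length xs
sum-map-1 [] = refl
sum-map-1 (x ∷ xs) = cong suc (sum-map-1 xs)

sum-map-suc : ∀ (f : A → ℕ) xs →
              sum (map (λ x → suc (f x)) xs) ≡ length xs + sum (map f xs)
sum-map-suc f xs = trans (sum-map-+ (λ _ → 1) f xs) (cong (_+ sum (map f xs)) (sum-map-1 xs))

sum-map-mono-≤ : ∀ {f g : A → ℕ} {xs} →
                 All (λ x → f x ≤ g x) xs → sum (map f xs) ≤ sum (map g xs)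
sum-map-mono-≤ All.[] = z≤n
sum-map-mono-≤ (fx≤gx All.∷ fxs≤gxs) = +-mono-≤ fx≤gx (sum-map-mono-≤ fxs≤gxs)

sum-map-cong : ∀ {f g : A → ℕ} {xs} →
               All (λ x → f x ≡ g x) xs → sum (map f xs) ≡ sum (map g xs)
sum-map-cong All.[] = refl
sum-map-cong (fx≡gx All.∷ fxs≡gxs) = cong₂ _+_ fx≡gx (sum-map-cong fxs≡gxs)

sum-map-upTo-suc : ∀ (f : ℕ → ℕ) n → sum (map f (upTo (suc n))) ≡ sum (map f (upTo n)) + f n
sum-map-upTo-suc f n = begin
  sum (map f (upTo (suc n)))       ≡⟨ cong (λ xs → sum (map f xs)) (sym (upTo-∷ʳ n)) ⟩
  sum (map f (upTo n ++ n ∷ []))   ≡⟨ cong sum (map-++ f (upTo n) (n ∷ [])) ⟩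
  sum (map f (upTo n) ++ f n ∷ []) ≡⟨ sum-++ (map f (upTo n)) (f n ∷ []) ⟩
  sum (map f (upTo n)) + (f n + 0) ≡⟨ cong (sum (map f (upTo n)) +_) (+-identityʳ (f n)) ⟩
  sum (map f (upTo n)) + f n       ∎
  where open ≡-Reasoning

sum-map-suc-upTo*2≡n*[1+n] : ∀ n → sum (map suc (upTo n)) * 2 ≡ n * suc n
sum-map-suc-upTo*2≡n*[1+n] zero = refl
sum-map-suc-upTo*2≡n*[1+n] (suc n) = begin
  sum (map suc (upTo (suc n))) * 2       ≡⟨ cong (_* 2) (sum-map-upTo-suc suc n) ⟩
  (sum (map suc (upTo n)) + suc n) * 2   ≡⟨ *-distribʳ-+ 2 (sum (map suc (upTo n))) (suc n) ⟩
  sum (map suc (upTo n)) * 2 + suc n * 2 ≡⟨ cong (_+ suc n * 2) (sum-map-suc-upTo*2≡n*[1+n] n) ⟩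
  n * suc n + suc n * 2                  ≡⟨ cong (_+ suc n * 2) (*-comm n (suc n)) ⟩
  suc n * n + suc n * 2                  ≡⟨ sym (*-distribˡ-+ (suc n) n 2) ⟩
  suc n * (n + 2)                        ≡⟨ cong (suc n *_) (+-comm n 2) ⟩
  suc n * suc (suc n)                    ∎
  where open ≡-Reasoning

sum-map-suc-upTo≡n*[1+n]/2 : ∀ n → sum (map suc (upTo n)) ≡ n * suc n / 2
sum-map-suc-upTo≡n*[1+n]/2 n = trans (sym (m*n/n≡m (sum (map suc (upTo n))) 2))
                                     (cong (_/ 2) (sum-map-suc-upTo*2≡n*[1+n] n))

m<n*[1+m/n] : ∀ m n .{{_ : NonZero n}} → m < n * suc (m / n)
m<n*[1+m/n] m n = begin-strict
  m                 ≡⟨ m≡m%n+[m/n]*n m n ⟩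
  m % n + m / n * n <⟨ +-monoˡ-< (m / n * n) (m%n<n m n) ⟩
  n + m / n * n     ≡⟨ cong (n +_) (*-comm (m / n) n) ⟩
  n + n * (m / n)   ≡⟨ sym (*-suc n (m / n)) ⟩
  n * suc (m / n)   ∎
  where open ≤-Reasoning

[1+k]*n/[1+n]≡k : ∀ {k n} → k < n → suc k * n / suc n ≡ k
[1+k]*n/[1+n]≡k {k} {n} k<n = begin
  suc k * n / suc n                       ≡⟨ /-congˡ split ⟩
  (n ∸ k + k * suc n) / suc n             ≡⟨ +-distrib-/-∣ʳ (n ∸ k) (n∣m*n k) ⟩
  (n ∸ k) / suc n + k * suc n / suc n     ≡⟨ cong₂ _+_ (m<n⇒m/n≡0 (s≤s (m∸n≤m n k))) (m*n/n≡m k (suc n)) ⟩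
  k                                       ∎
  where
  open ≡-Reasoning
  split : suc k * n ≡ n ∸ k + k * suc n
  split = begin
    n + k * n             ≡⟨ cong (_+ k * n) (sym (m∸n+n≡m (<⇒≤ k<n))) ⟩
    (n ∸ k + k) + k * n   ≡⟨ +-assoc (n ∸ k) k (k * n) ⟩
    n ∸ k + (k + k * n)   ≡⟨ cong (n ∸ k +_) (sym (*-suc k n)) ⟩
    n ∸ k + k * suc n     ∎

-- Σ_λ (d_λ − 1) = d − l, the codimension of the fixed vectors V^G (each V_d has a line of them).
codimFixed : List ℕ → ℕ
codimFixed ds = sum (map (_∸ 1) ds)

0<DV⇒0<codimFixed : ∀ ds → 0 < DV ds → 0 < codimFixed ds
0<DV⇒0<codimFixed (0 ∷ ds) 0<DV = 0<DV⇒0<codimFixed ds 0<DV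
0<DV⇒0<codimFixed (1 ∷ ds) 0<DV = 0<DV⇒0<codimFixed ds 0<DV
0<DV⇒0<codimFixed (suc (suc _) ∷ ds) _ = s≤s z≤n

dimV≡codimFixed+numSummands : ∀ {ds} → All (1 ≤_) ds → dimV ds ≡ codimFixed ds + numSummands ds
dimV≡codimFixed+numSummands All.[] = refl
dimV≡codimFixed+numSummands {suc n ∷ ds} (_ All.∷ 1≤ds) = begin
  suc n + dimV ds                          ≡⟨ cong (suc n +_) (dimV≡codimFixed+numSummands 1≤ds) ⟩
  suc (n + (codimFixed ds + length ds))    ≡⟨ cong suc (sym (+-assoc n (codimFixed ds) (length ds))) ⟩
  suc (n + codimFixed ds + length ds)      ≡⟨ sym (+-suc (n + codimFixed ds) (length ds)) ⟩
  n + codimFixed ds + suc (length ds)      ∎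
  where open ≡-Reasoning

module _ {P : ℕ} (pp : Prime (suc P)) where
  private
    p : ℕ
    p = suc P

  shtBlock-bound : ∀ j d → d ∸ 1 + (d ∸ 1) * d / 2 * j ≤ p * (d ∸ 1 + shtBlock p pp j d)
  shtBlock-bound j zero = z≤n
  shtBlock-bound j (suc n) = begin
    n + n * suc n / 2 * j
      ≡⟨ cong (λ t → n + t * j) (sym (sum-map-suc-upTo≡n*[1+n]/2 n)) ⟩
    n + sum (map suc (upTo n)) * j
      ≡⟨ cong₂ _+_ (sym (length-upTo n)) (sym (sum-map-*ʳ j suc (upTo n))) ⟩
    length (upTo n) + sum (map (λ k → suc k * j) (upTo n))
      ≡⟨ sym (sum-map-suc (λ k → suc k * j) (upTo n)) ⟩
    sum (map (λ k → suc (suc k * j)) (upTo n))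
      ≤⟨ sum-map-mono-≤ (All.universal (λ k → m<n*[1+m/n] (suc k * j) p) (upTo n)) ⟩
    sum (map (λ k → p * suc (q k)) (upTo n))
      ≡⟨ sum-map-*ˡ p (λ k → suc (q k)) (upTo n) ⟩
    p * sum (map (λ k → suc (q k)) (upTo n))
      ≡⟨ cong (p *_) (sum-map-suc q (upTo n)) ⟩
    p * (length (upTo n) + shtBlock p pp j (suc n))
      ≡⟨ cong (λ l → p * (l + shtBlock p pp j (suc n))) (length-upTo n) ⟩
    p * (n + shtBlock p pp j (suc n)) ∎
    where
    open ≤-Reasoning
    q : ℕ → ℕ
    q k = ⌊ suc k * j / p ⌋[ pp ]

  shtBlock-at-p∸1 : ∀ {d} → d ≤ p → d ∸ 1 + shtBlock p pp P d ≡ (d ∸ 1) * d / 2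
  shtBlock-at-p∸1 {zero} _ = refl
  shtBlock-at-p∸1 {suc n} (s≤s n≤P) = begin
    n + shtBlock p pp P (suc n)
      ≡⟨ cong (_+ shtBlock p pp P (suc n)) (sym (length-upTo n)) ⟩
    length (upTo n) + shtBlock p pp P (suc n)
      ≡⟨ sym (sum-map-suc q (upTo n)) ⟩
    sum (map (λ k → suc (q k)) (upTo n))
      ≡⟨ sum-map-cong (All.tabulate (λ k∈ → cong suc ([1+k]*n/[1+n]≡k (<-≤-trans (∈-upTo⁻ k∈) n≤P)))) ⟩
    sum (map suc (upTo n))
      ≡⟨ sum-map-suc-upTo≡n*[1+n]/2 n ⟩
    n * suc n / 2 ∎
    where
    open ≡-Reasoning
    q : ℕ → ℕ
    q k = ⌊ suc k * P / p ⌋[ pp ]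

  sht-bound : ∀ j ds → codimFixed ds + DV ds * j ≤ p * (codimFixed ds + sht p pp ds j)
  sht-bound j ds = begin
    codimFixed ds + DV ds * j
      ≡⟨ cong (codimFixed ds +_) (sym (sum-map-*ʳ j T ds)) ⟩
    codimFixed ds + sum (map (λ d → T d * j) ds)
      ≡⟨ sym (sum-map-+ (_∸ 1) (λ d → T d * j) ds) ⟩
    sum (map (λ d → d ∸ 1 + T d * j) ds)
      ≤⟨ sum-map-mono-≤ (All.universal (shtBlock-bound j) ds) ⟩
    sum (map (λ d → p * (d ∸ 1 + shtBlock p pp j d)) ds)
      ≡⟨ sum-map-*ˡ p (λ d → d ∸ 1 + shtBlock p pp j d) ds ⟩
    p * sum (map (λ d → d ∸ 1 + shtBlock p pp j d) ds)
      ≡⟨ cong (p *_) (sum-map-+ (_∸ 1) (shtBlock p pp j) ds) ⟩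
    p * (codimFixed ds + sht p pp ds j) ∎
    where
    open ≤-Reasoning
    T : ℕ → ℕ
    T d = (d ∸ 1) * d / 2

  sht-at-p∸1 : ∀ {ds} → All (_≤ p) ds → codimFixed ds + sht p pp ds P ≡ DV ds
  sht-at-p∸1 {ds} ds≤p = trans (sym (sum-map-+ (_∸ 1) (shtBlock p pp P) ds))
                               (sum-map-cong (All.map shtBlock-at-p∸1 ds≤p))

  j<codimFixed+sht : ∀ ds j → DV ds ≡ p → j < codimFixed ds + sht p pp ds j
  j<codimFixed+sht ds j DV≡p = *-cancelˡ-< p j _ (begin-strict
    p * j                               <⟨ m<n+m (p * j) 0<codimFixed ⟩
    codimFixed ds + p * j               ≡⟨ cong (λ c → codimFixed ds + c * j) (sym DV≡p) ⟩
    codimFixed ds + DV ds * j           ≤⟨ sht-bound j ds ⟩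
    p * (codimFixed ds + sht p pp ds j) ∎)
    where
    open ≤-Reasoning
    0<codimFixed : 0 < codimFixed ds
    0<codimFixed = 0<DV⇒0<codimFixed ds (subst (0 <_) (sym DV≡p) (s≤s z≤n))

𝐯≡codimFixed+sht : ∀ {p} (pp : Prime p) {ds} j → All (1 ≤_) ds →
                   𝐯 p pp ds j ≡ ℤ.+ (codimFixed ds + sht p pp ds j)
𝐯≡codimFixed+sht {p} pp {ds} j 1≤ds = begin
  (ℤ.+ dimV ds - ℤ.+ l) ℤ.+ ℤ.+ s      ≡⟨ cong (λ n → (ℤ.+ n - ℤ.+ l) ℤ.+ ℤ.+ s) (dimV≡codimFixed+numSummands 1≤ds) ⟩
  (ℤ.+ (c + l) - ℤ.+ l) ℤ.+ ℤ.+ s      ≡⟨ cong (λ i → (i - ℤ.+ l) ℤ.+ ℤ.+ s) (ℤ.pos-+ c l) ⟩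
  ((ℤ.+ c ℤ.+ ℤ.+ l) - ℤ.+ l) ℤ.+ ℤ.+ s ≡⟨ solve 3 (λ c l s → ((c :+ l) :- l) :+ s := c :+ s) refl (ℤ.+ c) (ℤ.+ l) (ℤ.+ s) ⟩
  ℤ.+ c ℤ.+ ℤ.+ s                     ≡⟨ sym (ℤ.pos-+ c s) ⟩
  ℤ.+ (c + s)                         ∎
  where
  open ≡-Reasoning
  open ℤ-Solver.+-*-Solver
  c = codimFixed ds
  l = numSummands ds
  s = sht p pp ds j

[j-a]-[1+j+e]≡-[1+a+e] : ∀ j a e → (ℤ.+ j - ℤ.+ a) - ℤ.+ (suc j + e) ≡ -[1+ (a + e) ]
[j-a]-[1+j+e]≡-[1+a+e] j a e = begin
  (ℤ.+ j - ℤ.+ a) - ℤ.+ (suc j + e)          ≡⟨ cong ((ℤ.+ j - ℤ.+ a) -_) (ℤ.pos-+ (suc j) e) ⟩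
  (ℤ.+ j - ℤ.+ a) - (ℤ.+ suc j ℤ.+ ℤ.+ e)     ≡⟨ cong (λ i → (ℤ.+ j - ℤ.+ a) - (i ℤ.+ ℤ.+ e)) (ℤ.pos-+ 1 j) ⟩
  (ℤ.+ j - ℤ.+ a) - ((ℤ.+ 1 ℤ.+ ℤ.+ j) ℤ.+ ℤ.+ e)
    ≡⟨ solve 3 (λ j a e → (j :- a) :- ((con (ℤ.+ 1) :+ j) :+ e) := :- ((con (ℤ.+ 1) :+ a) :+ e)) refl (ℤ.+ j) (ℤ.+ a) (ℤ.+ e) ⟩
  ℤ.- ((ℤ.+ 1 ℤ.+ ℤ.+ a) ℤ.+ ℤ.+ e)           ≡⟨ cong ℤ.-_ (sym (ℤ.pos-+ (suc a) e)) ⟩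
  -[1+ (a + e) ]                            ∎
  where
  open ≡-Reasoning
  open ℤ-Solver.+-*-Solver

dimC-𝐯≡-[1+⌊j/p⌋+e] : ∀ {p} (pp : Prime p) {ds} j {e} → All (1 ≤_) ds →
                      codimFixed ds + sht p pp ds j ≡ suc j + e →
                      dimC p pp j - 𝐯 p pp ds j ≡ -[1+ (⌊ j / p ⌋[ pp ] + e) ]
dimC-𝐯≡-[1+⌊j/p⌋+e] {p} pp {ds} j {e} 1≤ds gap = begin
  dimC p pp j - 𝐯 p pp ds j                         ≡⟨ cong (dimC p pp j -_) (𝐯≡codimFixed+sht pp j 1≤ds) ⟩
  dimC p pp j - ℤ.+ (codimFixed ds + sht p pp ds j) ≡⟨ cong (λ n → dimC p pp j - ℤ.+ n) gap ⟩
  dimC p pp j - ℤ.+ (suc j + e)                     ≡⟨ [j-a]-[1+j+e]≡-[1+a+e] j ⌊ j / p ⌋[ pp ] e ⟩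
  -[1+ (⌊ j / p ⌋[ pp ] + e) ]                      ∎
  where open ≡-Reasoning

lemma4p1p5p1 : (p : ℕ) → (pp : Prime p) → (ds : List ℕ) →
    All (λ d → 1 ≤ d × d ≤ p) ds → DV ds ≡ p →
    ((j : ℕ) → 0 < j → ¬ (p ∣ j) → dimC p pp j - 𝐯 p pp ds j ≤ℤ -[1+ 0 ]) ×
    (dimC p pp (p ∸ 1) - 𝐯 p pp ds (p ∸ 1) ≡ -[1+ 0 ])
lemma4p1p5p1 zero pp = ⊥-elim (NonZero.nonZero (prime⇒nonZero pp))
lemma4p1p5p1 (suc P) pp ds bounds DV≡p = jump-bound , jump-at-p∸1
  where
  1≤ds : All (1 ≤_) ds
  1≤ds = All.map proj₁ bounds

  jump-bound : (j : ℕ) → 0 < j → ¬ (suc P ∣ j) → dimC (suc P) pp j - 𝐯 (suc P) pp ds j ≤ℤ -[1+ 0 ]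
  jump-bound j _ _ with e , gap ← m≤n⇒∃[o]m+o≡n (j<codimFixed+sht pp ds j DV≡p) =
    ℤ.≤-trans (ℤ.≤-reflexive (dimC-𝐯≡-[1+⌊j/p⌋+e] pp j 1≤ds (sym gap))) (ℤ.-≤- z≤n)

  jump-at-p∸1 : dimC (suc P) pp P - 𝐯 (suc P) pp ds P ≡ -[1+ 0 ]
  jump-at-p∸1 = begin
    dimC (suc P) pp P - 𝐯 (suc P) pp ds P ≡⟨ dimC-𝐯≡-[1+⌊j/p⌋+e] pp P 1≤ds gap ⟩
    -[1+ (⌊ P / suc P ⌋[ pp ] + 0) ]     ≡⟨ cong (λ a → -[1+ (a + 0) ]) (m<n⇒m/n≡0 (n<1+n P)) ⟩
    -[1+ 0 ]                             ∎
    where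
    open ≡-Reasoning
    gap : codimFixed ds + sht (suc P) pp ds P ≡ suc P + 0
    gap = trans (sht-at-p∸1 pp (All.map proj₂ bounds)) (trans DV≡p (sym (+-identityʳ (suc P))))
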